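{- Let $P\in\{0,1\}^{n\times(n-1)}$. Then there exists $p\in\{0,1\}^n$ such that every $v\in\{0,1\}^n$ for which $[\,P\mid v\,]\in\{0,1\}^{n\times n}$ is nonsingular and $\mathrm{conv}\{0,\text{columns of }[\,P\mid v\,]\}$ is an acute simplex satisfies $v\in\{p,\overline{p}\}$, where $\overline{p}=e^n-p$.
   Context: $e^n$ is the all-ones vector. A simplex is acute if each dihedral angle ($\pi$ minus the angle between the inward normals of two facets) is less than $\pi/2$. -}

module Defs where

open import Data.Nat using (ℕ; zero; suc)
open import Data.Fin using (Fin; zero; suc)
open import Data.Bool using (Bool; true; false; not)
open import Data.Rational using (ℚ; 0ℚ; 1ℚ; _+_; _*_; _-_; _<_)
open import Relation.Binary.PropositionalEquality using (_≡_; _≢_)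
open import Data.Product using (_×_)

-- Vectors in ℚ^n and n×n matrices (M i j = entry in row i, column j).
Vecℚ : ℕ → Set
Vecℚ n = Fin n → ℚ

Matℚ : ℕ → Set
Matℚ n = Fin n → Fin n → ℚ

sumF : ∀ {n} → (Fin n → ℚ) → ℚ
sumF {zero}  f = 0ℚ
sumF {suc n} f = f zero + sumF (λ i → f (suc i))

dot : ∀ {n} → Vecℚ n → Vecℚ n → ℚ
dot x y = sumF (λ i → x i * y i)

_−ᵥ_ : ∀ {n} → Vecℚ n → Vecℚ n → Vecℚ n
(x −ᵥ y) i = x i - y i

bit : Bool → ℚ
bit true  = 1ℚ
bit false = 0ℚ

-- append one more element at the end: (f 0, …, f (m-1), a)
appendLast : ∀ {m} {A : Set} → (Fin m → A) → A → Fin (suc m) → A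
appendLast {zero}  f a zero    = a
appendLast {suc m} f a zero    = f zero
appendLast {suc m} f a (suc j) = appendLast (λ k → f (suc k)) a j

-- The n×n matrix [ P | v ] for P ∈ {0,1}^{n×(n-1)}, v ∈ {0,1}^n, n = suc m.
augment : ∀ {m} → (Fin (suc m) → Fin m → Bool) → (Fin (suc m) → Bool) → Matℚ (suc m)
augment P v i = appendLast (λ j → bit (P i j)) (bit (v i))

col : ∀ {n} → Matℚ n → Fin n → Vecℚ n
col M j i = M i j

Nonsingular : ∀ {n} → Matℚ n → Set
Nonsingular {n} M =
  (c : Vecℚ n) → (∀ i → sumF (λ j → M i j * c j) ≡ 0ℚ) → ∀ j → c j ≡ 0ℚ

-- Vertices of conv{0, columns of M}: vertex 0 is the origin, vertex (suc j) is column j.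
simplexVerts : ∀ {n} → Matℚ n → Fin (suc n) → Vecℚ n
simplexVerts M zero    i = 0ℚ
simplexVerts M (suc j) = col M j

InwardNormal : ∀ {n} → (Fin (suc n) → Vecℚ n) → Fin (suc n) → Vecℚ n → Set
InwardNormal w k a =
  (∀ i j → i ≢ k → j ≢ k → dot a (w i −ᵥ w j) ≡ 0ℚ) ×
  (∀ i → i ≢ k → 0ℚ < dot a (w k −ᵥ w i))

-- Acute simplex: every dihedral angle (π minus the angle between inward normals of two
-- distinct facets) is < π/2, i.e. the angle between the inward normals is > π/2,
-- i.e. their inner product is negative.
AcuteSimplex : ∀ {n} → (Fin (suc n) → Vecℚ n) → Set
AcuteSimplex {n} w =
  (k l : Fin (suc n)) → k ≢ l → (a b : Vecℚ n) →
  InwardNormal w k a → InwardNormal w l b → dot a b < 0ℚ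

module Submission where

-- Let P be a 0/1 matrix of size n × (n-1), n = m + 1.  Its n-1 columns have a
-- nonzero common orthogonal vector q, which depends on P only; we take p to be
-- the sign pattern of q.  Now let v make M = [P | v] nonsingular with an acute
-- simplex conv{0, columns of M}, and let A = M⁻¹ with rows A₀ … A_{n-1}.
-- The rows Aⱼ are inward normals of the facets opposite the columns, and
-- a₀ = -Σⱼ Aⱼ is the inward normal of the facet opposite the origin, so
-- acuteness says that the Gram matrix G = A Aᵀ has negative off-diagonal entries
-- and positive column sums.  From Aᵀ = M G and the 0/1 entries of M one reads off
-- that row N of A has exactly the sign pattern of column N of M.  Since q is
-- orthogonal to all columns of M except the last, q = s · A_last for a scalar
-- s ≠ 0, hence the sign pattern of q is v (if s > 0) or its complement (s < 0).

open import Defs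
open import Data.Nat using (ℕ; suc; zero)
open import Data.Fin using (Fin; zero; suc; punchIn; punchOut; fromℕ)
open import Data.Fin.Properties using (punchIn-punchOut; punchInᵢ≢i; suc-injective; all?; ¬∀⟶∃¬)
  renaming (_≟_ to _≟ᶠ_)
open import Data.Bool using (Bool; not; true; false)
open import Data.Bool.Properties using (not-involutive)
open import Data.Product using (∃; Σ; _,_; proj₁; proj₂)
open import Data.Sum using (_⊎_; inj₁; inj₂)
import Data.Sum as Sum
open import Data.Empty using (⊥-elim)
open import Relation.Nullary using (yes; no; does)
open import Relation.Nullary.Decidable using (dec-true; dec-false)
open import Relation.Binary.PropositionalEquality
open import Relation.Binary.Definitions using (Tri; tri<; tri≈; tri>)
open import Data.Rational
  using (ℚ; 0ℚ; 1ℚ; _+_; _*_; _-_; -_; _<_; _≤_; 1/_; ≢-nonZero; positive; negative)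
import Data.Rational.Properties as Q
open import Data.Rational.Solver using (module +-*-Solver)
open +-*-Solver using (solve; _:=_; _:+_; _:-_; _:*_; :-_; con)

cancel-nonzero : ∀ {a b : ℚ} → a ≢ 0ℚ → a * b ≡ 0ℚ → b ≡ 0ℚ
cancel-nonzero {a} {b} a≢0 ab≡0 = begin
    b                ≡⟨ sym (Q.*-identityˡ b) ⟩
    1ℚ * b           ≡⟨ cong (_* b) (sym (Q.*-inverseˡ a)) ⟩
    (1/ a) * a * b   ≡⟨ Q.*-assoc (1/ a) a b ⟩
    (1/ a) * (a * b) ≡⟨ cong ((1/ a) *_) ab≡0 ⟩
    (1/ a) * 0ℚ      ≡⟨ Q.*-zeroʳ (1/ a) ⟩
    0ℚ               ∎
  where open ≡-Reasoning
        instance _ = ≢-nonZero a≢0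

difference-zero : ∀ {a b : ℚ} → a - b ≡ 0ℚ → a ≡ b
difference-zero {a} {b} a-b≡0 = begin
    a            ≡⟨ solve 2 (λ a b → a := (a :- b) :+ b) refl a b ⟩
    (a - b) + b  ≡⟨ cong (_+ b) a-b≡0 ⟩
    0ℚ + b       ≡⟨ Q.+-identityˡ b ⟩
    b            ∎
  where open ≡-Reasoning

sum-cong : ∀ {n} {f g : Fin n → ℚ} → (∀ i → f i ≡ g i) → sumF f ≡ sumF g
sum-cong {zero}  f≡g = refl
sum-cong {suc n} f≡g = cong₂ _+_ (f≡g zero) (sum-cong (λ i → f≡g (suc i)))

sum-zero : ∀ {n} {f : Fin n → ℚ} → (∀ i → f i ≡ 0ℚ) → sumF f ≡ 0ℚ
sum-zero {zero}  f≡0 = refl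
sum-zero {suc n} f≡0 =
  trans (cong₂ _+_ (f≡0 zero) (sum-zero (λ i → f≡0 (suc i)))) (Q.+-identityˡ 0ℚ)

sum-+ : ∀ {n} (f g : Fin n → ℚ) → sumF (λ i → f i + g i) ≡ sumF f + sumF g
sum-+ {zero}  f g = refl
sum-+ {suc n} f g =
  trans (cong ((f zero + g zero) +_) (sum-+ (λ i → f (suc i)) (λ i → g (suc i))))
        (solve 4 (λ a b c d → (a :+ b) :+ (c :+ d) := (a :+ c) :+ (b :+ d)) refl
               (f zero) (g zero) (sumF (λ i → f (suc i))) (sumF (λ i → g (suc i))))

sum-*ˡ : ∀ {n} (c : ℚ) (f : Fin n → ℚ) → sumF (λ i → c * f i) ≡ c * sumF f
sum-*ˡ {zero}  c f = sym (Q.*-zeroʳ c)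
sum-*ˡ {suc n} c f =
  trans (cong ((c * f zero) +_) (sum-*ˡ c (λ i → f (suc i))))
        (sym (Q.*-distribˡ-+ c (f zero) (sumF (λ i → f (suc i)))))

sum-*ʳ : ∀ {n} (c : ℚ) (f : Fin n → ℚ) → sumF (λ i → f i * c) ≡ sumF f * c
sum-*ʳ c f = trans (sum-cong (λ i → Q.*-comm (f i) c)) (trans (sum-*ˡ c f) (Q.*-comm c _))

sum-neg : ∀ {n} (f : Fin n → ℚ) → sumF (λ i → - f i) ≡ - sumF f
sum-neg {zero}  f = refl
sum-neg {suc n} f =
  trans (cong ((- f zero) +_) (sum-neg (λ i → f (suc i))))
        (sym (Q.neg-distrib-+ (f zero) _))

sum-swap : ∀ {n m} (f : Fin n → Fin m → ℚ) →
  sumF (λ i → sumF (λ j → f i j)) ≡ sumF (λ j → sumF (λ i → f i j))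
sum-swap {zero} {m} f = sym (sum-zero {m} (λ j → refl))
sum-swap {suc n} f =
  trans (cong (sumF (f zero) +_) (sum-swap (λ i j → f (suc i) j)))
        (sym (sum-+ (f zero) (λ j → sumF (λ i → f (suc i) j))))

sum-extract : ∀ {n} (f : Fin (suc n) → ℚ) (k : Fin (suc n)) →
  sumF f ≡ f k + sumF (λ s → f (punchIn k s))
sum-extract f zero = refl
sum-extract {suc n} f (suc k) =
  trans (cong (f zero +_) (sum-extract (λ i → f (suc i)) k))
        (solve 3 (λ a b c → a :+ (b :+ c) := b :+ (a :+ c)) refl (f zero) (f (suc k)) _)

sum-at : ∀ {n} (f : Fin (suc n) → ℚ) (k : Fin (suc n)) →
  (∀ s → f (punchIn k s) ≡ 0ℚ) → sumF f ≡ f k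
sum-at f k rest≡0 =
  trans (sum-extract f k) (trans (cong (f k +_) (sum-zero rest≡0)) (Q.+-identityʳ (f k)))

sum-mono-≤ : ∀ {n} {f g : Fin n → ℚ} → (∀ i → f i ≤ g i) → sumF f ≤ sumF g
sum-mono-≤ {zero}  f≤g = Q.≤-refl
sum-mono-≤ {suc n} f≤g = Q.+-mono-≤ (f≤g zero) (sum-mono-≤ (λ i → f≤g (suc i)))

sum-mono-< : ∀ {n} {f g : Fin (suc n) → ℚ} → (∀ i → f i ≤ g i) →
  (k : Fin (suc n)) → f k < g k → sumF f < sumF g
sum-mono-< {f = f} {g} f≤g k fk<gk = begin-strict
    sumF f                             ≡⟨ sum-extract f k ⟩
    f k + sumF (λ s → f (punchIn k s)) <⟨ Q.+-mono-<-≤ fk<gk (sum-mono-≤ (λ s → f≤g (punchIn k s))) ⟩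
    g k + sumF (λ s → g (punchIn k s)) ≡⟨ sym (sum-extract g k) ⟩
    sumF g                             ∎
  where open Q.≤-Reasoning

punchIn-cover : ∀ {n} {P : Fin (suc n) → Set} (k : Fin (suc n)) →
  P k → (∀ s → P (punchIn k s)) → ∀ i → P i
punchIn-cover {P = P} k Pk Prest i with k ≟ᶠ i
... | yes refl = Pk
... | no k≢i   = subst P (punchIn-punchOut k≢i) (Prest (punchOut k≢i))

zero-or-nonzero : ∀ {k} (g : Fin k → ℚ) → (∀ t → g t ≡ 0ℚ) ⊎ ∃ λ t → g t ≢ 0ℚ
zero-or-nonzero {k} g with all? (λ t → g t Q.≟ 0ℚ)
... | yes all≡0 = inj₁ all≡0
... | no ¬all≡0 = inj₂ (¬∀⟶∃¬ k (λ t → g t ≡ 0ℚ) (λ t → g t Q.≟ 0ℚ) ¬all≡0)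

δ : ∀ {n} → Fin n → Fin n → ℚ
δ i j with i ≟ᶠ j
... | yes _ = 1ℚ
... | no _  = 0ℚ

δ-refl : ∀ {n} (i : Fin n) → δ i i ≡ 1ℚ
δ-refl i with i ≟ᶠ i
... | yes _   = refl
... | no i≢i  = ⊥-elim (i≢i refl)

δ-neq : ∀ {n} {i j : Fin n} → i ≢ j → δ i j ≡ 0ℚ
δ-neq {i = i} {j} i≢j with i ≟ᶠ j
... | yes i≡j = ⊥-elim (i≢j i≡j)
... | no _    = refl

δ-sym : ∀ {n} (i j : Fin n) → δ i j ≡ δ j i
δ-sym i j with i ≟ᶠ j
... | yes refl = sym (δ-refl i)
... | no i≢j   = sym (δ-neq (λ j≡i → i≢j (sym j≡i)))

δ-punchIn : ∀ {n} (k : Fin (suc n)) (s : Fin n) → δ k (punchIn k s) ≡ 0ℚ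
δ-punchIn k s = δ-neq (λ k≡ → punchInᵢ≢i k s (sym k≡))

dot-comm : ∀ {n} (a b : Vecℚ n) → dot a b ≡ dot b a
dot-comm a b = sum-cong (λ i → Q.*-comm (a i) (b i))

dot-sub : ∀ {n} (a x y : Vecℚ n) → dot a (x −ᵥ y) ≡ dot a x - dot a y
dot-sub {zero}  a x y = refl
dot-sub {suc n} a x y =
  trans (cong ((a zero * (x zero - y zero)) +_)
              (dot-sub (λ i → a (suc i)) (λ i → x (suc i)) (λ i → y (suc i))))
        (solve 5 (λ a x y s t → a :* (x :- y) :+ (s :- t) := (a :* x :+ s) :- (a :* y :+ t)) refl
               (a zero) (x zero) (y zero) _ _)

dot-scale : ∀ {n} (t : ℚ) (x y : Vecℚ n) → dot (λ i → t * x i) y ≡ t * dot x y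
dot-scale t x y =
  trans (sum-cong (λ i → Q.*-assoc t (x i) (y i))) (sum-*ˡ t (λ i → x i * y i))

-- Linearity in the first argument, in the form used by Gaussian elimination.
dot-combination : ∀ {n} (a c y : Vecℚ n) (b : ℚ) →
  dot (λ i → a i - b * c i) y ≡ dot a y - b * dot c y
dot-combination {zero}  a c y b = sym (solve 1 (λ b → con 0ℚ :- b :* con 0ℚ := con 0ℚ) refl b)
dot-combination {suc n} a c y b =
  trans (cong ((a zero - b * c zero) * y zero +_)
              (dot-combination (λ i → a (suc i)) (λ i → c (suc i)) (λ i → y (suc i)) b))
        (solve 6 (λ a b c y s t → (a :- b :* c) :* y :+ (s :- b :* t)
                                  := (a :* y :+ s) :- b :* (c :* y :+ t)) refl
               (a zero) b (c zero) (y zero) _ _)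

dot-assoc : ∀ {n m} (x : Fin n → ℚ) (M : Fin n → Fin m → ℚ) (y : Fin m → ℚ) →
  dot x (λ i → dot (M i) y) ≡ dot (λ j → dot x (λ i → M i j)) y
dot-assoc x M y = begin
    sumF (λ i → x i * sumF (λ j → M i j * y j))
  ≡⟨ sum-cong (λ i → sym (sum-*ˡ (x i) (λ j → M i j * y j))) ⟩
    sumF (λ i → sumF (λ j → x i * (M i j * y j)))
  ≡⟨ sum-swap (λ i j → x i * (M i j * y j)) ⟩
    sumF (λ j → sumF (λ i → x i * (M i j * y j)))
  ≡⟨ sum-cong (λ j → trans (sum-cong (λ i → sym (Q.*-assoc (x i) (M i j) (y j))))
                            (sum-*ʳ (y j) (λ i → x i * M i j))) ⟩
    sumF (λ j → sumF (λ i → x i * M i j) * y j)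
  ∎
  where open ≡-Reasoning

dot-δ : ∀ {n} (k : Fin (suc n)) (y : Vecℚ (suc n)) → dot (δ k) y ≡ y k
dot-δ k y =
  trans (sum-at (λ j → δ k j * y j) k
                (λ s → trans (cong (_* y (punchIn k s)) (δ-punchIn k s)) (Q.*-zeroˡ (y (punchIn k s)))))
        (trans (cong (_* y k) (δ-refl k)) (Q.*-identityˡ (y k)))

record CommonZero {k n : ℕ} (R : Fin k → Vecℚ n) : Set where
  field
    vec         : Vecℚ n
    annihilated : ∀ t → dot (R t) vec ≡ 0ℚ
    support     : Fin n
    nonzero     : vec support ≢ 0ℚ

open CommonZero

e₀ : ∀ {n} → Vecℚ (suc n)
e₀ zero    = 1ℚ
e₀ (suc _) = 0ℚ

dot-e₀ : ∀ {n} (a : Vecℚ (suc n)) → dot a e₀ ≡ a zero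
dot-e₀ a = trans (sum-at (λ i → a i * e₀ i) zero (λ s → Q.*-zeroʳ (a (suc s))))
                 (Q.*-identityʳ (a zero))

-- One step of Gaussian elimination: subtract multiples of the pivot form R t₀
-- (pivot entry R t₀ 0, with inverse c⁻¹) from the other forms and drop the
-- first coordinate.
reduce : ∀ {k n} (R : Fin (suc k) → Vecℚ (suc n)) (t₀ : Fin (suc k)) (c⁻¹ : ℚ) →
  Fin k → Vecℚ n
reduce R t₀ c⁻¹ s i = R (punchIn t₀ s) (suc i) - (R (punchIn t₀ s) zero * c⁻¹) * R t₀ (suc i)

eliminate : ∀ {k n} (R : Fin (suc k) → Vecℚ (suc n)) (t₀ : Fin (suc k)) →
  (pivot≢0 : R t₀ zero ≢ 0ℚ) → CommonZero (reduce R t₀ (1/_ (R t₀ zero) {{≢-nonZero pivot≢0}})) →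
  CommonZero R
eliminate R t₀ pivot≢0 Z = record
  { vec = x ; annihilated = punchIn-cover t₀ pivot-row other-rows
  ; support = suc (support Z) ; nonzero = nonzero Z }
  where
    instance _ = ≢-nonZero pivot≢0
    c = R t₀ zero
    c⁻¹ = 1/ c
    y = vec Z
    D = dot (λ i → R t₀ (suc i)) y
    x : Vecℚ _
    x zero    = - (D * c⁻¹)
    x (suc i) = y i
    pivot-row : dot (R t₀) x ≡ 0ℚ
    pivot-row = begin
        c * - (D * c⁻¹) + D ≡⟨ solve 3 (λ c d i → c :* (:- (d :* i)) :+ d := d :* (con 1ℚ :- c :* i)) refl c D c⁻¹ ⟩
        D * (1ℚ - c * c⁻¹)  ≡⟨ cong (λ z → D * (1ℚ - z)) (Q.*-inverseʳ c) ⟩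
        D * (1ℚ - 1ℚ)       ≡⟨ solve 1 (λ d → d :* (con 1ℚ :- con 1ℚ) := con 0ℚ) refl D ⟩
        0ℚ                  ∎
      where open ≡-Reasoning
    other-rows : ∀ s → dot (R (punchIn t₀ s)) x ≡ 0ℚ
    other-rows s = begin
        r₀ * - (D * c⁻¹) + dot (λ i → Rₛ (suc i)) y
      ≡⟨ solve 4 (λ r d i a → r :* (:- (d :* i)) :+ a := a :- (r :* i) :* d) refl r₀ D c⁻¹ _ ⟩
        dot (λ i → Rₛ (suc i)) y - (r₀ * c⁻¹) * D
      ≡⟨ sym (dot-combination (λ i → Rₛ (suc i)) (λ i → R t₀ (suc i)) y (r₀ * c⁻¹)) ⟩
        dot (reduce R t₀ c⁻¹ s) y
      ≡⟨ annihilated Z s ⟩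
        0ℚ
      ∎
      where open ≡-Reasoning
            Rₛ = R (punchIn t₀ s)
            r₀ = Rₛ zero

underdetermined : ∀ k (R : Fin k → Vecℚ (suc k)) → CommonZero R
underdetermined zero R = record { vec = e₀ ; annihilated = λ () ; support = zero ; nonzero = Q.1≢0 }
underdetermined (suc k) R with zero-or-nonzero (λ t → R t zero)
... | inj₁ first≡0 = record
  { vec = e₀ ; annihilated = λ t → trans (dot-e₀ (R t)) (first≡0 t)
  ; support = zero ; nonzero = Q.1≢0 }
... | inj₂ (t₀ , pivot≢0) =
  eliminate R t₀ pivot≢0 (underdetermined k (reduce R t₀ (1/ R t₀ zero)))
  where instance _ = ≢-nonZero pivot≢0

_ᵀ : ∀ {n} → Matℚ n → Matℚ n
(M ᵀ) i j = M j i

-- A nonsingular matrix has injective transpose: aᵀ M = 0 forces a = 0.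
-- If a i₀ ≠ 0, take c ≠ 0 orthogonal to the rows other than i₀; then M c is
-- supported at i₀ and a · (M c) = (aᵀ M) · c = 0 forces (M c) i₀ = 0, so M c = 0.
transpose-injective : ∀ {n} {M : Matℚ n} → Nonsingular M → (a : Vecℚ n) →
  (∀ j → dot (col M j) a ≡ 0ℚ) → ∀ i → a i ≡ 0ℚ
transpose-injective {suc k} {M} ns a aᵀM≡0 i₀ with a i₀ Q.≟ 0ℚ
... | yes a≡0 = a≡0
... | no  a≢0 = ⊥-elim (nonzero Z (ns c Mc≡0 (support Z)))
  where
    Z = underdetermined k (λ s → M (punchIn i₀ s))
    c = vec Z
    Mc : Vecℚ (suc k)
    Mc i = dot (M i) c
    a·Mc≡0 : dot a Mc ≡ 0ℚ
    a·Mc≡0 = trans (dot-assoc a M c)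
      (sum-zero (λ j → trans (cong (_* c j) (trans (dot-comm a (col M j)) (aᵀM≡0 j)))
                             (Q.*-zeroˡ (c j))))
    Mc-at-i₀ : Mc i₀ ≡ 0ℚ
    Mc-at-i₀ = cancel-nonzero a≢0
      (trans (sym (sum-at (λ i → a i * Mc i) i₀
                          (λ s → trans (cong (a (punchIn i₀ s) *_) (annihilated Z s))
                                       (Q.*-zeroʳ (a (punchIn i₀ s))))))
             a·Mc≡0)
    Mc≡0 : ∀ i → Mc i ≡ 0ℚ
    Mc≡0 = punchIn-cover i₀ Mc-at-i₀ (annihilated Z)

pairing-determines : ∀ {n} {M : Matℚ n} → Nonsingular M → (x y : Vecℚ n) →
  (∀ j → dot x (col M j) ≡ dot y (col M j)) → ∀ i → x i ≡ y i
pairing-determines {M = M} ns x y same i =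
  difference-zero (transpose-injective {M = M} ns (x −ᵥ y) differ i)
  where
    differ : ∀ j → dot (col M j) (x −ᵥ y) ≡ 0ℚ
    differ j = begin
        dot (col M j) (x −ᵥ y)                  ≡⟨ dot-sub (col M j) x y ⟩
        dot (col M j) x - dot (col M j) y        ≡⟨ cong₂ _-_ (dot-comm (col M j) x) (dot-comm (col M j) y) ⟩
        dot x (col M j) - dot y (col M j)        ≡⟨ cong (_- dot y (col M j)) (same j) ⟩
        dot y (col M j) - dot y (col M j)        ≡⟨ Q.+-inverseʳ (dot y (col M j)) ⟩
        0ℚ                                       ∎
      where open ≡-Reasoning

pairing-with-rest-nonzero : ∀ {k} {M : Matℚ (suc k)} → Nonsingular M →
  (N : Fin (suc k)) (q : Vecℚ (suc k)) {i : Fin (suc k)} → q i ≢ 0ℚ →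
  (∀ s → dot q (col M (punchIn N s)) ≡ 0ℚ) → dot q (col M N) ≢ 0ℚ
pairing-with-rest-nonzero {M = M} ns N q {i} qᵢ≢0 q⊥rest q·colN≡0 =
  qᵢ≢0 (transpose-injective {M = M} ns q (punchIn-cover N (flip q·colN≡0) (λ s → flip (q⊥rest s))) i)
  where
    flip : ∀ {j} → dot q (col M j) ≡ 0ℚ → dot (col M j) q ≡ 0ℚ
    flip {j} = trans (dot-comm (col M j) q)

DualTo : ∀ {n} → Matℚ n → Fin n → Vecℚ n → Set
DualTo M N r = ∀ j → dot r (col M j) ≡ δ N j

-- The dual basis exists: rescale a nonzero vector orthogonal to the other columns.
dual-vector : ∀ {k} {M : Matℚ (suc k)} → Nonsingular M → (N : Fin (suc k)) →
  Σ (Vecℚ (suc k)) (DualTo M N)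
dual-vector {k} {M} ns N = r , punchIn-cover N r·colN r⊥rest
  where
    Z = underdetermined k (λ s → col M (punchIn N s))
    x = vec Z
    x⊥rest : ∀ s → dot x (col M (punchIn N s)) ≡ 0ℚ
    x⊥rest s = trans (dot-comm x (col M (punchIn N s))) (annihilated Z s)
    d = dot x (col M N)
    instance _ = ≢-nonZero (pairing-with-rest-nonzero {M = M} ns N x (nonzero Z) x⊥rest)
    r : Vecℚ (suc k)
    r i = (1/ d) * x i
    r·colN : dot r (col M N) ≡ δ N N
    r·colN = trans (dot-scale (1/ d) x (col M N)) (trans (Q.*-inverseˡ d) (sym (δ-refl N)))
    r⊥rest : ∀ s → dot r (col M (punchIn N s)) ≡ δ N (punchIn N s)
    r⊥rest s = trans (dot-scale (1/ d) x (col M (punchIn N s)))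
      (trans (cong ((1/ d) *_) (x⊥rest s)) (trans (Q.*-zeroʳ (1/ d)) (sym (δ-punchIn N s))))

orthogonal-multiple-of-dual : ∀ {k} {M : Matℚ (suc k)} → Nonsingular M →
  (N : Fin (suc k)) (r : Vecℚ (suc k)) → DualTo M N r → (q : Vecℚ (suc k)) →
  (∀ s → dot q (col M (punchIn N s)) ≡ 0ℚ) → ∀ i → q i ≡ dot q (col M N) * r i
orthogonal-multiple-of-dual {M = M} ns N r r-dual q q⊥rest =
  pairing-determines {M = M} ns q (λ i → σ * r i) (punchIn-cover N at-N at-rest)
  where
    σ = dot q (col M N)
    scaled : ∀ j → dot (λ i → σ * r i) (col M j) ≡ σ * δ N j
    scaled j = trans (dot-scale σ r (col M j)) (cong (σ *_) (r-dual j))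
    at-N : dot q (col M N) ≡ dot (λ i → σ * r i) (col M N)
    at-N = sym (trans (scaled N) (trans (cong (σ *_) (δ-refl N)) (Q.*-identityʳ σ)))
    at-rest : ∀ s → dot q (col M (punchIn N s)) ≡ dot (λ i → σ * r i) (col M (punchIn N s))
    at-rest s = trans (q⊥rest s)
      (sym (trans (scaled (punchIn N s)) (trans (cong (σ *_) (δ-punchIn N s)) (Q.*-zeroʳ σ))))

-- If A M = I then Aᵀ is nonsingular: cᵀ A = 0 gives cᵀ = cᵀ A M = 0.
left-inverse-transpose : ∀ {k} {M A : Matℚ (suc k)} → (∀ j → DualTo M j (A j)) →
  Nonsingular (A ᵀ)
left-inverse-transpose {M = M} {A} AM≡I c cᵀA≡0 l = sym (begin
    0ℚ                                       ≡⟨ sym (sum-zero (λ i → Q.*-zeroˡ (M i l))) ⟩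
    dot (λ i → 0ℚ) (col M l)                 ≡⟨ sym (sum-cong (λ i → cong (_* M i l)
                                                   (trans (dot-comm c (col A i)) (cᵀA≡0 i)))) ⟩
    dot (λ i → dot c (col A i)) (col M l)    ≡⟨ sym (dot-assoc c A (col M l)) ⟩
    dot c (λ j → dot (A j) (col M l))        ≡⟨ sum-cong (λ j → cong (c j *_) (AM≡I j l)) ⟩
    dot c (λ j → δ j l)                      ≡⟨ dot-comm c (λ j → δ j l) ⟩
    dot (λ j → δ j l) c                      ≡⟨ sum-cong (λ j → cong (_* c j) (δ-sym j l)) ⟩
    dot (δ l) c                              ≡⟨ dot-δ l c ⟩
    c l                                      ∎)
  where open ≡-Reasoning

-- The inverse of a nonsingular matrix M: its rows A N are the dual basis of the
-- columns (A M = I), and it is also a right inverse (M A = I).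
module Inverse {k : ℕ} (M : Matℚ (suc k)) (ns : Nonsingular M) where

  A : Matℚ (suc k)
  A N = proj₁ (dual-vector {M = M} ns N)

  A-dual : ∀ N → DualTo M N (A N)
  A-dual N = proj₂ (dual-vector {M = M} ns N)

  -- M A = I: both sides of column l have the same pairing A j l with each row A j.
  right-inverse : ∀ i l → dot (M i) (col A l) ≡ δ i l
  right-inverse i l = pairing-determines {M = A ᵀ} (left-inverse-transpose {M = M} {A} A-dual)
    (λ i → dot (M i) (col A l)) (λ i → δ i l) same i
    where
      open ≡-Reasoning
      same : ∀ j → dot (λ i → dot (M i) (col A l)) (A j) ≡ dot (λ i → δ i l) (A j)
      same j = begin
          dot (λ i → dot (M i) (col A l)) (A j)   ≡⟨ dot-comm (λ i → dot (M i) (col A l)) (A j) ⟩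
          dot (A j) (λ i → dot (M i) (col A l))   ≡⟨ dot-assoc (A j) M (col A l) ⟩
          dot (λ i → dot (A j) (col M i)) (col A l) ≡⟨ sum-cong (λ i → cong (_* A i l) (A-dual j i)) ⟩
          dot (δ j) (col A l)                      ≡⟨ dot-δ j (col A l) ⟩
          A j l                                    ≡⟨ sym (dot-δ l (A j)) ⟩
          dot (δ l) (A j)                          ≡⟨ sum-cong (λ i → cong (_* A j i) (δ-sym l i)) ⟩
          dot (λ i → δ i l) (A j)                  ∎

  -- Every row of M is nonzero, since row i pairs to 1 with column i of A.
  row-nonzero : ∀ i → ∃ λ j → M i j ≢ 0ℚ
  row-nonzero i with zero-or-nonzero (M i)
  ... | inj₂ nonzero-entry = nonzero-entry
  ... | inj₁ row≡0 = ⊥-elim (Q.1≢0 (begin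
      1ℚ                    ≡⟨ sym (δ-refl i) ⟩
      δ i i                 ≡⟨ sym (right-inverse i i) ⟩
      dot (M i) (col A i)   ≡⟨ sum-zero (λ j → trans (cong (_* A j i) (row≡0 j)) (Q.*-zeroˡ (A j i))) ⟩
      0ℚ                    ∎))
    where open ≡-Reasoning

positive-gap : ∀ {β x : ℚ} → β < x → 0ℚ < x - β
positive-gap {β} {x} β<x = subst (_< x - β) (Q.+-inverseʳ β) (Q.+-monoˡ-< (- β) β<x)

level-normal : ∀ {n} (w : Fin (suc n) → Vecℚ n) (k : Fin (suc n)) (a : Vecℚ n) (β : ℚ) →
  (∀ i → i ≢ k → dot a (w i) ≡ β) → β < dot a (w k) → InwardNormal w k a
level-normal w k a β on-facet β<apex = facet⊥ , points-inward
  where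
    facet⊥ : ∀ i j → i ≢ k → j ≢ k → dot a (w i −ᵥ w j) ≡ 0ℚ
    facet⊥ i j i≢k j≢k = trans (dot-sub a (w i) (w j))
      (trans (cong₂ _-_ (on-facet i i≢k) (on-facet j j≢k)) (Q.+-inverseʳ β))
    points-inward : ∀ i → i ≢ k → 0ℚ < dot a (w k −ᵥ w i)
    points-inward i i≢k = subst (0ℚ <_)
      (sym (trans (dot-sub a (w k) (w i)) (cong (λ z → dot a (w k) - z) (on-facet i i≢k))))
      (positive-gap β<apex)

module SimplexNormals {k : ℕ} (M : Matℚ (suc k)) (ns : Nonsingular M) where
  open Inverse M ns public

  w : Fin (suc (suc k)) → Vecℚ (suc k)
  w = simplexVerts M

  -- Row A j vanishes on the origin and the columns l ≠ j, and is 1 on column j.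
  row-normal : ∀ j → InwardNormal w (suc j) (A j)
  row-normal j = level-normal w (suc j) (A j) 0ℚ on-facet
    (subst (0ℚ <_) (sym (trans (A-dual j j) (δ-refl j))) (Q.positive⁻¹ 1ℚ))
    where
      on-facet : ∀ i → i ≢ suc j → dot (A j) (w i) ≡ 0ℚ
      on-facet zero    _       = sum-zero (λ i → Q.*-zeroʳ (A j i))
      on-facet (suc l) l≢j = trans (A-dual j l) (δ-neq (λ j≡l → l≢j (cong suc (sym j≡l))))

  -- The inward normal of the facet opposite the origin.
  a₀ : Vecℚ (suc k)
  a₀ l = - sumF (λ j → A j l)

  a₀-pairing : ∀ (y : Vecℚ (suc k)) → dot a₀ y ≡ - sumF (λ j → dot (A j) y)
  a₀-pairing y = begin
      sumF (λ l → - sumF (λ j → A j l) * y l)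
    ≡⟨ sum-cong (λ l → trans (sym (Q.neg-distribˡ-* (sumF (λ j → A j l)) (y l)))
                             (cong -_ (sym (sum-*ʳ (y l) (λ j → A j l))))) ⟩
      sumF (λ l → - sumF (λ j → A j l * y l))
    ≡⟨ sum-neg (λ l → sumF (λ j → A j l * y l)) ⟩
      - sumF (λ l → sumF (λ j → A j l * y l))
    ≡⟨ cong -_ (sum-swap (λ l j → A j l * y l)) ⟩
      - sumF (λ j → dot (A j) y)
    ∎
    where open ≡-Reasoning

  -- a₀ is -1 on every column, since the rows of A pair with column l to δ · l.
  a₀-on-column : ∀ l → dot a₀ (col M l) ≡ - 1ℚ
  a₀-on-column l = trans (a₀-pairing (col M l)) (cong -_ (begin
      sumF (λ j → dot (A j) (col M l)) ≡⟨ sum-cong (λ j → A-dual j l) ⟩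
      sumF (λ j → δ j l)               ≡⟨ sum-at (λ j → δ j l) l
                                            (λ s → trans (δ-sym (punchIn l s) l) (δ-punchIn l s)) ⟩
      δ l l                            ≡⟨ δ-refl l ⟩
      1ℚ                               ∎))
    where open ≡-Reasoning

  origin-normal : InwardNormal w zero a₀
  origin-normal = level-normal w zero a₀ (- 1ℚ) on-facet
    (subst (- 1ℚ <_) (sym (sum-zero (λ i → Q.*-zeroʳ (a₀ i)))) (Q.negative⁻¹ (- 1ℚ)))
    where
      on-facet : ∀ i → i ≢ zero → dot a₀ (w i) ≡ - 1ℚ
      on-facet zero    0≢0 = ⊥-elim (0≢0 refl)
      on-facet (suc l) _   = a₀-on-column l

module AcuteGram {k : ℕ} (M : Matℚ (suc k)) (ns : Nonsingular M)
                 (acute : AcuteSimplex (simplexVerts M)) where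
  open SimplexNormals M ns public

  G : Fin (suc k) → Fin (suc k) → ℚ
  G j l = dot (A j) (A l)

  gram-offdiag-neg : ∀ j l → j ≢ l → G j l < 0ℚ
  gram-offdiag-neg j l j≢l =
    acute (suc j) (suc l) (λ sj≡sl → j≢l (suc-injective sj≡sl)) (A j) (A l) (row-normal j) (row-normal l)

  -- a₀ · A N = - Σⱼ G j N is negative by acuteness at the origin's facet.
  gram-colsum-pos : ∀ N → 0ℚ < sumF (λ j → G j N)
  gram-colsum-pos N = subst (0ℚ <_) (solve 1 (λ x → :- (:- x) := x) refl S) (Q.neg-antimono-< -S<0)
    where
      S = sumF (λ j → G j N)
      -S<0 : - S < 0ℚ
      -S<0 = subst (_< 0ℚ) (a₀-pairing (A N))
        (acute zero (suc N) (λ ()) a₀ (A N) origin-normal (row-normal N))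

  -- Aᵀ = M G, a consequence of M A = I.
  row-via-gram : ∀ N i → A N i ≡ dot (M i) (λ j → G j N)
  row-via-gram N i = sym (begin
      dot (M i) (λ j → dot (A j) (A N))      ≡⟨ dot-assoc (M i) A (A N) ⟩
      dot (λ l → dot (M i) (col A l)) (A N)  ≡⟨ sum-cong (λ l → cong (_* A N l) (right-inverse i l)) ⟩
      dot (δ i) (A N)                        ≡⟨ dot-δ i (A N) ⟩
      A N i                                  ∎)
    where open ≡-Reasoning

Binary : ℚ → Set
Binary x = x ≡ 0ℚ ⊎ x ≡ 1ℚ

bit-binary : ∀ b → Binary (bit b)
bit-binary false = inj₁ refl
bit-binary true  = inj₂ refl

SignOf : Bool → ℚ → Set
SignOf true  x = 0ℚ < x
SignOf false x = x < 0ℚ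

binary-scale-nonpos : ∀ {m x : ℚ} → Binary m → x ≤ 0ℚ → m * x ≤ 0ℚ
binary-scale-nonpos {x = x} (inj₁ refl) x≤0 = Q.≤-reflexive (Q.*-zeroˡ x)
binary-scale-nonpos {x = x} (inj₂ refl) x≤0 = subst (_≤ 0ℚ) (sym (Q.*-identityˡ x)) x≤0

binary-scale-increase : ∀ {m x : ℚ} → Binary m → x ≤ 0ℚ → x ≤ m * x
binary-scale-increase {x = x} (inj₁ refl) x≤0 = subst (x ≤_) (sym (Q.*-zeroˡ x)) x≤0
binary-scale-increase {x = x} (inj₂ refl) x≤0 = Q.≤-reflexive (sym (Q.*-identityˡ x))

sign-scale-pos : ∀ {s x : ℚ} {b} → 0ℚ < s → SignOf b x → SignOf b (s * x)
sign-scale-pos {s} {x} {true}  0<s 0<x = subst (_< s * x) (Q.*-zeroʳ s) (Q.*-monoʳ-<-pos s {{positive 0<s}} 0<x)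
sign-scale-pos {s} {x} {false} 0<s x<0 = subst (s * x <_) (Q.*-zeroʳ s) (Q.*-monoʳ-<-pos s {{positive 0<s}} x<0)

sign-scale-neg : ∀ {s x : ℚ} {b} → s < 0ℚ → SignOf b x → SignOf (not b) (s * x)
sign-scale-neg {s} {x} {true}  s<0 0<x = subst (s * x <_) (Q.*-zeroʳ s) (Q.*-monoʳ-<-neg s {{negative s<0}} 0<x)
sign-scale-neg {s} {x} {false} s<0 x<0 = subst (_< s * x) (Q.*-zeroʳ s) (Q.*-monoʳ-<-neg s {{negative s<0}} x<0)

sign-decode : ∀ {b x} → SignOf b x → b ≡ does (0ℚ Q.<? x)
sign-decode {true}  {x} 0<x = sym (dec-true (0ℚ Q.<? x) 0<x)
sign-decode {false} {x} x<0 = sym (dec-false (0ℚ Q.<? x) (Q.<-asym x<0))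

-- Write A N i = Σⱼ M i j G j N.
-- If M i N = 0 all summands are ≤ 0, and the one at a nonzero entry j of row i
-- (necessarily j ≠ N) is < 0.  If M i N = 1 each summand is ≥ G j N, and
-- Σⱼ G j N > 0.
module BinaryAcute {k : ℕ} (M : Matℚ (suc k)) (ns : Nonsingular M)
                   (acute : AcuteSimplex (simplexVerts M)) (binary : ∀ i j → Binary (M i j)) where
  open AcuteGram M ns acute public

  dual-sign : ∀ N i b → M i N ≡ bit b → SignOf b (A N i)
  dual-sign N i false MiN≡0 = subst (_< 0ℚ) (sym (row-via-gram N i))
    (Q.<-≤-trans (sum-mono-< summand≤0 j₁ summand<0) (Q.≤-reflexive (sum-zero {suc k} (λ _ → refl))))
    where
      j₁ = proj₁ (row-nonzero i)
      Mij₁≢0 = proj₂ (row-nonzero i)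
      summand≤0 : ∀ j → M i j * G j N ≤ 0ℚ
      summand≤0 j with j ≟ᶠ N
      ... | yes refl = Q.≤-reflexive (trans (cong (_* G j N) MiN≡0) (Q.*-zeroˡ (G j N)))
      ... | no j≢N   = binary-scale-nonpos (binary i j) (Q.<⇒≤ (gram-offdiag-neg j N j≢N))
      Mij₁≡1 : M i j₁ ≡ 1ℚ
      Mij₁≡1 with binary i j₁
      ... | inj₁ Mij₁≡0 = ⊥-elim (Mij₁≢0 Mij₁≡0)
      ... | inj₂ Mij₁≡1 = Mij₁≡1
      j₁≢N : j₁ ≢ N
      j₁≢N refl = Mij₁≢0 MiN≡0
      summand<0 : M i j₁ * G j₁ N < 0ℚ
      summand<0 = subst (_< 0ℚ) (sym (trans (cong (_* G j₁ N) Mij₁≡1) (Q.*-identityˡ (G j₁ N))))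
        (gram-offdiag-neg j₁ N j₁≢N)
  dual-sign N i true MiN≡1 = subst (0ℚ <_) (sym (row-via-gram N i))
    (Q.<-≤-trans (gram-colsum-pos N) (sum-mono-≤ G≤summand))
    where
      G≤summand : ∀ j → G j N ≤ M i j * G j N
      G≤summand j with j ≟ᶠ N
      ... | yes refl = Q.≤-reflexive (sym (trans (cong (_* G j N) MiN≡1) (Q.*-identityˡ (G j N))))
      ... | no j≢N   = binary-scale-increase (binary i j) (Q.<⇒≤ (gram-offdiag-neg j N j≢N))

-- Main lemma: for M as above, a nonzero vector q orthogonal to all columns but
-- column N is a nonzero multiple of row N of M⁻¹, so up to a global sign it has
-- the sign pattern of column N.
column-sign-pattern : ∀ {k} (M : Matℚ (suc k)) → Nonsingular M →
  AcuteSimplex (simplexVerts M) → (∀ i j → Binary (M i j)) →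
  (N : Fin (suc k)) (b : Fin (suc k) → Bool) → (∀ i → M i N ≡ bit (b i)) →
  (q : Vecℚ (suc k)) {i : Fin (suc k)} → q i ≢ 0ℚ → (∀ s → dot q (col M (punchIn N s)) ≡ 0ℚ) →
  (∀ i → SignOf (b i) (q i)) ⊎ (∀ i → SignOf (not (b i)) (q i))
column-sign-pattern M ns acute binary N b column-N q qᵢ≢0 q⊥rest = by-sign (Q.<-cmp σ 0ℚ)
  where
    open BinaryAcute M ns acute binary
    σ = dot q (col M N)
    q≡σA : ∀ i → q i ≡ σ * A N i
    q≡σA = orthogonal-multiple-of-dual {M = M} ns N (A N) (A-dual N) q q⊥rest
    row-sign : ∀ i → SignOf (b i) (A N i)
    row-sign i = dual-sign N i (b i) (column-N i)
    by-sign : Tri (σ < 0ℚ) (σ ≡ 0ℚ) (0ℚ < σ) →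
      (∀ i → SignOf (b i) (q i)) ⊎ (∀ i → SignOf (not (b i)) (q i))
    by-sign (tri< σ<0 _ _) =
      inj₂ (λ i → subst (SignOf (not (b i))) (sym (q≡σA i)) (sign-scale-neg σ<0 (row-sign i)))
    by-sign (tri≈ _ σ≡0 _) = ⊥-elim (pairing-with-rest-nonzero {M = M} ns N q qᵢ≢0 q⊥rest σ≡0)
    by-sign (tri> _ _ 0<σ) =
      inj₁ (λ i → subst (SignOf (b i)) (sym (q≡σA i)) (sign-scale-pos 0<σ (row-sign i)))

appendLast-last : ∀ {m} {A : Set} (f : Fin m → A) (a : A) → appendLast f a (fromℕ m) ≡ a
appendLast-last {zero}  f a = refl
appendLast-last {suc m} f a = appendLast-last (λ j → f (suc j)) a

appendLast-punchIn : ∀ {m} {A : Set} (f : Fin m → A) (a : A) (j : Fin m) →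
  appendLast f a (punchIn (fromℕ m) j) ≡ f j
appendLast-punchIn {suc m} f a zero    = refl
appendLast-punchIn {suc m} f a (suc j) = appendLast-punchIn (λ k → f (suc k)) a j

augment-binary : ∀ {m} (P : Fin (suc m) → Fin m → Bool) (v : Fin (suc m) → Bool) →
  ∀ i j → Binary (augment P v i j)
augment-binary {m} P v i = punchIn-cover (fromℕ m)
  (subst Binary (sym (appendLast-last (λ j → bit (P i j)) (bit (v i)))) (bit-binary (v i)))
  (λ t → subst Binary (sym (appendLast-punchIn (λ j → bit (P i j)) (bit (v i)) t)) (bit-binary (P i t)))

-- The corollary.  The vector q orthogonal to the columns of P is chosen before v,
-- and p is its sign pattern.
corollary6p2 : (m : ℕ) → (P : Fin (suc m) → Fin m → Bool) →
    ∃ λ (p : Fin (suc m) → Bool) → (v : Fin (suc m) → Bool) →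
      Nonsingular (augment P v) → AcuteSimplex (simplexVerts (augment P v)) →
      (∀ i → v i ≡ p i) ⊎ (∀ i → v i ≡ not (p i))
corollary6p2 m P = p , classify
  where
    Z = underdetermined m (λ t i → bit (P i t))
    q = vec Z
    p : Fin (suc m) → Bool
    p i = does (0ℚ Q.<? q i)
    classify : (v : Fin (suc m) → Bool) →
      Nonsingular (augment P v) → AcuteSimplex (simplexVerts (augment P v)) →
      (∀ i → v i ≡ p i) ⊎ (∀ i → v i ≡ not (p i))
    classify v ns acute = Sum.map
      (λ same i → sign-decode (same i))
      (λ opposite i → trans (sym (not-involutive (v i))) (cong not (sign-decode (opposite i))))
      (column-sign-pattern (augment P v) ns acute (augment-binary P v) (fromℕ m) v
         (λ i → appendLast-last (λ j → bit (P i j)) (bit (v i))) q (nonzero Z) q⊥P)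
      where
        q⊥P : ∀ t → dot q (col (augment P v) (punchIn (fromℕ m) t)) ≡ 0ℚ
        q⊥P t = trans (sum-cong (λ i → trans (cong (q i *_) (appendLast-punchIn (λ j → bit (P i j)) (bit (v i)) t))
                                              (Q.*-comm (q i) (bit (P i t)))))
                      (annihilated Z t)
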